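{- Consider an IRPS-LP with dual variables $\phi$, a factor $i\in\mathbb{F}$ and $J\subseteq\mathcal{N}_{\mathbb{G}}(i)$. Let $x_i^*,x_i^{**}\in\arg\min_{x_i\in X_i}\langle\theta^\phi_i,x_i\rangle$ be two minimizers. If $\Delta\in AD(\theta^\phi_i,x_i^*,J)$, then $\Delta\in AD(\theta^\phi_i,x_i^{**},J)$.
   Context: IRPS-LP setting: $\mathbb{F}=\{1,\dots,k\}$ finite set of factors, $\mathbb{E}\subseteq\binom{\mathbb{F}}{2}$, factor graph $\mathbb{G}=(\mathbb{F},\mathbb{E})$, $\mathcal{N}_{\mathbb{G}}(i)=\{j:ij\in\mathbb{E}\}$; $X_i\subseteq\{0,1\}^{d_i}$, $\theta_i\in\mathbb{R}^{d_i}$; for $ij\in\mathbb{E}$ matrices $A_{(i,j)}\in\{0,1\}^{K\times d_i}$, $A_{(j,i)}\in\{0,1\}^{K\times d_j}$ with $A_{(i,j)}x_i\in\{0,1\}^K$ for all $x_i\in X_i$ and $A_{(j,i)}x_j\in\{0,1\}^K$ for all $x_j\in X_j$. Dual variables $\phi_{(i,j)}\in\mathbb{R}^K$ with $\phi_{(i,j)}=-\phi_{(j,i)}$; $\theta^\phi_i:=\theta_i+\sum_{j:\,ij\in\mathbb{E}}A_{(i,j)}^\top\phi_{(i,j)}$. For a minimizer $x_i^*$ of $\langle\theta^\phi_i,\cdot\rangle$ over $X_i$, $AD(\theta^\phi_i,x_i^*,J)$ (admissible increments w.r.t. $x_i^*$) is the set of dual increments $\Delta$ whose only nonzero components are $\Delta_{(i,j)}$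 and $\Delta_{(j,i)}=-\Delta_{(i,j)}$ for $j\in J$, such that for each $j\in J$, with $\nu:=A_{(i,j)}x_i^*$, $\Delta_{(i,j)}(s)\ge0$ when $\nu(s)=1$ and $\Delta_{(i,j)}(s)\le0$ when $\nu(s)=0$, and $x_i^*\in\arg\min_{x_i\in X_i}\langle\theta^\phi_i+\sum_{j\in J}A_{(i,j)}^\top\Delta_{(i,j)},x_i\rangle$. -}

module Defs where

open import Level using (Level; _⊔_) renaming (suc to lsuc; zero to lzero)
open import Algebra.Bundles using (CommutativeRing)
open import Relation.Binary.Core using (Rel)
open import Relation.Binary.Structures using (IsTotalOrder)
open import Relation.Binary.PropositionalEquality using (_≡_)
open import Data.Nat as ℕ using (ℕ; zero; suc)
open import Data.Fin using (Fin; zero; suc)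
open import Data.Bool using (Bool; true; false; if_then_else_; _∧_)
open import Data.Product using (_×_)
open import Data.Sum using (_⊎_)
open import Relation.Nullary using (¬_)
open import Function using (_∘_)

-- Scalars: a totally ordered commutative ring (ℝ is an instance).

record OrderedCommutativeRing (c ℓ₁ ℓ₂ : Level) : Set (lsuc (c ⊔ ℓ₁ ⊔ ℓ₂)) where
  field
    commutativeRing : CommutativeRing c ℓ₁
  open CommutativeRing commutativeRing public
  field
    _≤_          : Rel Carrier ℓ₂
    isTotalOrder : IsTotalOrder _≈_ _≤_
    +-mono-≤     : ∀ {x y} z → x ≤ y → (x + z) ≤ (y + z)
    *-nonneg     : ∀ {x y} → 0# ≤ x → 0# ≤ y → 0# ≤ (x * y)

∑ℕ : ∀ {n} → (Fin n → ℕ) → ℕ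
∑ℕ {zero}  f = 0
∑ℕ {suc n} f = f zero ℕ.+ ∑ℕ (f ∘ suc)

[_]ℕ : Bool → ℕ
[ true  ]ℕ = 1
[ false ]ℕ = 0

_·ℕ_ : ∀ {K d} → (Fin K → Fin d → Bool) → (Fin d → Bool) → Fin K → ℕ
(M ·ℕ x) s = ∑ℕ (λ t → [ M s t ∧ x t ]ℕ)

module _ {c ℓ₁ ℓ₂ : Level} (R : OrderedCommutativeRing c ℓ₁ ℓ₂) where
  open OrderedCommutativeRing R using (Carrier; _≈_; _≤_; _+_; _*_; -_; 0#; 1#)

  ∑ : ∀ {n} → (Fin n → Carrier) → Carrier
  ∑ {zero}  f = 0#
  ∑ {suc n} f = f zero + ∑ (f ∘ suc)

  ⟦_⟧ : Bool → Carrier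
  ⟦ true  ⟧ = 1#
  ⟦ false ⟧ = 0#

  ⟨_,_⟩ : ∀ {n} → (Fin n → Carrier) → (Fin n → Bool) → Carrier
  ⟨ θ , x ⟩ = ∑ (λ t → θ t * ⟦ x t ⟧)

  IsMinimizer : ∀ {n} → ((Fin n → Bool) → Set) → (Fin n → Carrier) → (Fin n → Bool) → Set (ℓ₂)
  IsMinimizer X θ x = X x × (∀ y → X y → ⟨ θ , x ⟩ ≤ ⟨ θ , y ⟩)

  _ᵀ·_ : ∀ {K d} → (Fin K → Fin d → Bool) → (Fin K → Carrier) → Fin d → Carrier
  (M ᵀ· ψ) t = ∑ (λ s → ⟦ M s t ⟧ * ψ s)

  record IRPSLP : Set (lsuc lzero ⊔ c) where
    field
      k       : ℕ                                   -- factors 𝔽 = Fin k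
      E       : Fin k → Fin k → Bool                -- edges of the factor graph
      E-sym   : ∀ i j → E i j ≡ E j i
      E-irr   : ∀ i → E i i ≡ false
      d       : Fin k → ℕ
      X       : (i : Fin k) → (Fin (d i) → Bool) → Set
      θ       : (i : Fin k) → Fin (d i) → Carrier
      K       : ℕ
      A       : (i j : Fin k) → Fin K → Fin (d i) → Bool
      A-bin   : ∀ i j → E i j ≡ true → ∀ x → X i x → ∀ s → (A i j ·ℕ x) s ℕ.≤ 1

  module _ (P : IRPSLP) where
    open IRPSLP P

    DualVec : Set c
    DualVec = (i j : Fin k) → Fin K → Carrier

    IsDual : DualVec → Set ℓ₁
    IsDual φ = ∀ i j → E i j ≡ true → ∀ s → φ i j s ≈ - φ j i s

    θᵠ : DualVec → (i : Fin k) → Fin (d i) → Carrier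
    θᵠ φ i t = θ i t + ∑ (λ j → if E i j then (A i j ᵀ· φ i j) t else 0#)

    AD : (φ : DualVec) (i : Fin k) (J : Fin k → Bool) (x* : Fin (d i) → Bool) → DualVec → Set (ℓ₁ ⊔ ℓ₂)
    AD φ i J x* Δ =
        (∀ a b s → ¬ ((a ≡ i × J b ≡ true) ⊎ (b ≡ i × J a ≡ true)) → Δ a b s ≈ 0#)
      × (∀ j → J j ≡ true → ∀ s → Δ j i s ≈ - Δ i j s)
      × (∀ j → J j ≡ true → ∀ s →
            ((A i j ·ℕ x*) s ≡ 1 → 0# ≤ Δ i j s)
          × ((A i j ·ℕ x*) s ≡ 0 → Δ i j s ≤ 0#))
      × IsMinimizer (X i)
          (λ t → θᵠ φ i t + ∑ (λ j → if J j then (A i j ᵀ· Δ i j) t else 0#)) x*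

-- For feasible x write ν_j(x) := A_(i,j) x ∈ {0,1}^K. The increment Δ adds
-- g(x) := ∑_{j ∈ J} ⟨Δ_(i,j), ν_j(x)⟩ to the objective ⟨θᵠ_i, x⟩, and the sign conditions of AD say
-- exactly that ν_j(x*) maximises ⟨Δ_(i,j), ·⟩ coordinatewise over {0,1}^K, so g(x**) ≤ g(x*).
-- As x** ties with x* on θᵠ_i, it minimises the perturbed objective too. Conversely minimality of
-- x* forces g(x*) ≤ g(x**); a sum of termwise inequalities that is tight is tight termwise, and
-- wherever ν_j(x**) differs from ν_j(x*) this makes Δ_(i,j)(s) vanish.
module Submission where

open import Defs
open import Level using (Level)
open import Data.Fin using (Fin)
open import Data.Bool using (Bool; true)
open import Relation.Binary.PropositionalEquality using (_≡_)

open import Algebra.Bundles using (CommutativeMonoid)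
import Algebra.Properties.CommutativeSemigroup as CommutativeSemigroupProperties
import Algebra.Properties.Semiring.Mult as SemiringMult
open import Data.Bool using (false; if_then_else_; _∧_)
open import Data.Fin using (zero; suc)
open import Data.Nat using (ℕ; zero; suc; z≤n; s≤s)
import Data.Nat as ℕ
open import Data.Product using (_×_; _,_)
open import Function using (_∘_)
open import Relation.Binary.Bundles using (Poset)
import Relation.Binary.PropositionalEquality as ≡
open import Relation.Binary.Structures using (IsTotalOrder)
import Relation.Binary.Reasoning.PartialOrder as PosetReasoning
import Relation.Binary.Reasoning.Setoid as SetoidReasoning

module OrderedCommutativeRingProperties
  {c ℓ₁ ℓ₂ : Level} (R : OrderedCommutativeRing c ℓ₁ ℓ₂) where

  open OrderedCommutativeRing R public hiding (zero) renaming (+-mono-≤ to +-monoˡ-≤)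
  open CommutativeSemigroupProperties
    (CommutativeMonoid.commutativeSemigroup +-commutativeMonoid) using (interchange)
  open SemiringMult semiring using (×-homo-+; ×-homo-1) renaming (_×_ to _×ᴿ_)
  module ≤ = IsTotalOrder isTotalOrder

  ≤-resp₂-≈ : ∀ {x x′ y y′} → x ≈ x′ → y ≈ y′ → x ≤ y → x′ ≤ y′
  ≤-resp₂-≈ x≈x′ y≈y′ x≤y = ≤.≲-respʳ-≈ y≈y′ (≤.≲-respˡ-≈ x≈x′ x≤y)

  poset : Poset c ℓ₁ ℓ₂
  poset = record { isPartialOrder = ≤.isPartialOrder }

  fromℕ : ℕ → Carrier
  fromℕ m = m ×ᴿ 1#

  fromℕ-homo-+ : ∀ m n → fromℕ (m ℕ.+ n) ≈ fromℕ m + fromℕ n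
  fromℕ-homo-+ m n = ×-homo-+ 1# m n

  fromℕ-1 : fromℕ 1 ≈ 1#
  fromℕ-1 = ×-homo-1 1#

  +-monoʳ-≤ : ∀ {x y} z → x ≤ y → (z + x) ≤ (z + y)
  +-monoʳ-≤ z x≤y = ≤-resp₂-≈ (+-comm _ z) (+-comm _ z) (+-monoˡ-≤ z x≤y)

  +-mono-≤ : ∀ {w x y z} → w ≤ x → y ≤ z → (w + y) ≤ (x + z)
  +-mono-≤ {x = x} {y} w≤x y≤z = ≤.trans (+-monoˡ-≤ y w≤x) (+-monoʳ-≤ x y≤z)

  +-cancelʳ-≤ : ∀ {x y} z → (x + z) ≤ (y + z) → x ≤ y
  +-cancelʳ-≤ z x+z≤y+z = ≤-resp₂-≈ (cancel _) (cancel _) (+-monoˡ-≤ (- z) x+z≤y+z)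
    where
    cancel : ∀ x → (x + z) + - z ≈ x
    cancel x = trans (+-assoc x z (- z)) (trans (+-congˡ (-‿inverseʳ z)) (+-identityʳ x))

  +-cancelˡ-≤ : ∀ {x y} z → (z + x) ≤ (z + y) → x ≤ y
  +-cancelˡ-≤ z z+x≤z+y = +-cancelʳ-≤ z (≤-resp₂-≈ (+-comm z _) (+-comm z _) z+x≤z+y)

  ⟦⟧*⟦⟧≈fromℕ∧ : ∀ a b → ⟦_⟧ R a * ⟦_⟧ R b ≈ fromℕ [ a ∧ b ]ℕ
  ⟦⟧*⟦⟧≈fromℕ∧ true  true  = trans (*-identityʳ 1#) (sym fromℕ-1)
  ⟦⟧*⟦⟧≈fromℕ∧ true  false = zeroʳ 1#
  ⟦⟧*⟦⟧≈fromℕ∧ false b     = zeroˡ _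

  if-cong : ∀ b {x y} → x ≈ y → (if b then x else 0#) ≈ (if b then y else 0#)
  if-cong true  x≈y = x≈y
  if-cong false _   = refl

  if-mono-≤ : ∀ b {x y} → (b ≡ true → x ≤ y) → (if b then x else 0#) ≤ (if b then y else 0#)
  if-mono-≤ true  x≤y = x≤y ≡.refl
  if-mono-≤ false _   = ≤.refl

  if-injective : ∀ {b x y} → b ≡ true → (if b then x else 0#) ≈ (if b then y else 0#) → x ≈ y
  if-injective ≡.refl x≈y = x≈y

  -- At variable length ∑ is not definitionally the standard library's sum, so its laws are
  -- proved directly.

  private
    variable
      m n : ℕ

  ∑-cong : {f g : Fin n → Carrier} → (∀ t → f t ≈ g t) → ∑ R f ≈ ∑ R g
  ∑-cong {zero}  f≈g = refl
  ∑-cong {suc n} f≈g = +-cong (f≈g zero) (∑-cong (f≈g ∘ suc))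

  ∑-zero : ∀ n → ∑ R {n} (λ _ → 0#) ≈ 0#
  ∑-zero zero    = refl
  ∑-zero (suc n) = trans (+-identityˡ _) (∑-zero n)

  ∑-distrib-+ : (f g : Fin n → Carrier) → ∑ R (λ t → f t + g t) ≈ ∑ R f + ∑ R g
  ∑-distrib-+ {zero}  f g = sym (+-identityʳ 0#)
  ∑-distrib-+ {suc n} f g =
    trans (+-congˡ (∑-distrib-+ (f ∘ suc) (g ∘ suc))) (interchange _ _ _ _)

  *-distribˡ-∑ : ∀ x (f : Fin n → Carrier) → x * ∑ R f ≈ ∑ R (λ t → x * f t)
  *-distribˡ-∑ {zero}  x f = zeroʳ x
  *-distribˡ-∑ {suc n} x f = trans (distribˡ x _ _) (+-congˡ (*-distribˡ-∑ x (f ∘ suc)))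

  *-distribʳ-∑ : ∀ x (f : Fin n → Carrier) → ∑ R f * x ≈ ∑ R (λ t → f t * x)
  *-distribʳ-∑ {zero}  x f = zeroˡ x
  *-distribʳ-∑ {suc n} x f = trans (distribʳ x _ _) (+-congˡ (*-distribʳ-∑ x (f ∘ suc)))

  ∑-comm : (f : Fin m → Fin n → Carrier) →
           ∑ R (λ a → ∑ R (λ b → f a b)) ≈ ∑ R (λ b → ∑ R (λ a → f a b))
  ∑-comm {zero}  {n} f = sym (∑-zero n)
  ∑-comm {suc m} f =
    trans (+-congˡ (∑-comm (f ∘ suc))) (sym (∑-distrib-+ (f zero) _))

  fromℕ-∑ℕ : (f : Fin n → ℕ) → fromℕ (∑ℕ f) ≈ ∑ R (fromℕ ∘ f)
  fromℕ-∑ℕ {zero}  f = refl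
  fromℕ-∑ℕ {suc n} f = trans (fromℕ-homo-+ (f zero) _) (+-congˡ (fromℕ-∑ℕ (f ∘ suc)))

  ∑-mono-≤ : {f g : Fin n → Carrier} → (∀ t → f t ≤ g t) → ∑ R f ≤ ∑ R g
  ∑-mono-≤ {zero}  f≤g = ≤.refl
  ∑-mono-≤ {suc n} f≤g = +-mono-≤ (f≤g zero) (∑-mono-≤ (f≤g ∘ suc))

  ∑-mono-≤-rigid : {f g : Fin n → Carrier} → (∀ t → f t ≤ g t) →
                   ∑ R g ≤ ∑ R f → ∀ t → f t ≈ g t
  ∑-mono-≤-rigid {suc n} {f} {g} f≤g ∑g≤∑f = pointwise
    where
    head-≈ : f zero ≈ g zero
    head-≈ = ≤.antisym (f≤g zero)
      (+-cancelʳ-≤ (∑ R (f ∘ suc)) (≤.trans (+-monoʳ-≤ (g zero) (∑-mono-≤ (f≤g ∘ suc))) ∑g≤∑f))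
    tail-≥ : ∑ R (g ∘ suc) ≤ ∑ R (f ∘ suc)
    tail-≥ = +-cancelˡ-≤ (g zero) (≤.trans ∑g≤∑f (+-monoˡ-≤ _ (≤.reflexive head-≈)))
    pointwise : ∀ t → f t ≈ g t
    pointwise zero    = head-≈
    pointwise (suc t) = ∑-mono-≤-rigid (f≤g ∘ suc) tail-≥ t

  ⟨⟩-distrib-+ : ∀ (f g : Fin n → Carrier) x →
                 ⟨_,_⟩ R (λ t → f t + g t) x ≈ ⟨_,_⟩ R f x + ⟨_,_⟩ R g x
  ⟨⟩-distrib-+ f g x = trans (∑-cong (λ t → distribʳ (⟦_⟧ R (x t)) (f t) (g t)))
                           (∑-distrib-+ (λ t → f t * ⟦_⟧ R (x t)) (λ t → g t * ⟦_⟧ R (x t)))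

  ⟨⟩-distrib-∑ : ∀ (h : Fin m → Fin n → Carrier) x →
                 ⟨_,_⟩ R (λ t → ∑ R (λ j → h j t)) x ≈ ∑ R (λ j → ⟨_,_⟩ R (h j) x)
  ⟨⟩-distrib-∑ h x = trans (∑-cong (λ t → *-distribʳ-∑ (⟦_⟧ R (x t)) (λ j → h j t)))
                           (∑-comm (λ t j → h j t * ⟦_⟧ R (x t)))

  ⟨⟩-if : ∀ {n} b (f : Fin n → Carrier) x →
          ⟨_,_⟩ R (λ t → if b then f t else 0#) x ≈ (if b then ⟨_,_⟩ R f x else 0#)
  ⟨⟩-if true  f x = refl
  ⟨⟩-if {n} false f x = trans (∑-cong (λ t → zeroˡ (⟦_⟧ R (x t)))) (∑-zero n)

  ⟨ᵀ·⟩-adjoint : ∀ {K d} (M : Fin K → Fin d → Bool) (ψ : Fin K → Carrier) x →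
                 ⟨_,_⟩ R (_ᵀ·_ R M ψ) x ≈ ∑ R (λ s → ψ s * fromℕ ((M ·ℕ x) s))
  ⟨ᵀ·⟩-adjoint M ψ x = begin
    ∑ R (λ t → ∑ R (λ s → ⟦ M s t ⟧ᴿ * ψ s) * ⟦ x t ⟧ᴿ)
      ≈⟨ ∑-cong (λ t → *-distribʳ-∑ ⟦ x t ⟧ᴿ (λ s → ⟦ M s t ⟧ᴿ * ψ s)) ⟩
    ∑ R (λ t → ∑ R (λ s → ⟦ M s t ⟧ᴿ * ψ s * ⟦ x t ⟧ᴿ))
      ≈⟨ ∑-comm (λ t s → ⟦ M s t ⟧ᴿ * ψ s * ⟦ x t ⟧ᴿ) ⟩
    ∑ R (λ s → ∑ R (λ t → ⟦ M s t ⟧ᴿ * ψ s * ⟦ x t ⟧ᴿ))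
      ≈⟨ ∑-cong (λ s → ∑-cong (λ t → reorder (M s t) (x t) (ψ s))) ⟩
    ∑ R (λ s → ∑ R (λ t → ψ s * fromℕ [ M s t ∧ x t ]ℕ))
      ≈⟨ ∑-cong (λ s → sym (distribute (ψ s) (λ t → [ M s t ∧ x t ]ℕ))) ⟩
    ∑ R (λ s → ψ s * fromℕ ((M ·ℕ x) s)) ∎
    where
    open SetoidReasoning setoid
    ⟦_⟧ᴿ : Bool → Carrier
    ⟦_⟧ᴿ = ⟦_⟧ R
    distribute : ∀ y (f : Fin _ → ℕ) → y * fromℕ (∑ℕ f) ≈ ∑ R (λ t → y * fromℕ (f t))
    distribute y f = trans (*-congˡ (fromℕ-∑ℕ f)) (*-distribˡ-∑ y (fromℕ ∘ f))
    reorder : ∀ a b y → ⟦ a ⟧ᴿ * y * ⟦ b ⟧ᴿ ≈ y * fromℕ [ a ∧ b ]ℕ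
    reorder a b y = trans (*-congʳ (*-comm _ y)) (trans (*-assoc y _ _) (*-congˡ (⟦⟧*⟦⟧≈fromℕ∧ a b)))

  SignCompatible : ℕ → Carrier → Set ℓ₂
  SignCompatible m δ = (m ≡ 1 → 0# ≤ δ) × (m ≡ 0 → δ ≤ 0#)

  *-fromℕ-1 : ∀ δ → δ * fromℕ 1 ≈ δ
  *-fromℕ-1 δ = trans (*-congˡ fromℕ-1) (*-identityʳ δ)

  SignCompatible⇒maximal : ∀ {m* m} δ → m* ℕ.≤ 1 → m ℕ.≤ 1 → SignCompatible m* δ →
                           (δ * fromℕ m) ≤ (δ * fromℕ m*)
  SignCompatible⇒maximal δ z≤n       z≤n       _         = ≤.refl
  SignCompatible⇒maximal δ (s≤s z≤n) (s≤s z≤n) _         = ≤.refl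
  SignCompatible⇒maximal δ z≤n       (s≤s z≤n) (_ , δ≤0) =
    ≤-resp₂-≈ (sym (*-fromℕ-1 δ)) (sym (zeroʳ δ)) (δ≤0 ≡.refl)
  SignCompatible⇒maximal δ (s≤s z≤n) z≤n       (0≤δ , _) =
    ≤-resp₂-≈ (sym (zeroʳ δ)) (sym (*-fromℕ-1 δ)) (0≤δ ≡.refl)

  SignCompatible-transfer : ∀ {m* m} δ → m* ℕ.≤ 1 → m ℕ.≤ 1 → SignCompatible m* δ →
                            δ * fromℕ m ≈ δ * fromℕ m* → SignCompatible m δ
  SignCompatible-transfer δ z≤n       z≤n       compatible _ = compatible
  SignCompatible-transfer δ (s≤s z≤n) (s≤s z≤n) compatible _ = compatible
  SignCompatible-transfer δ z≤n       (s≤s z≤n) _ δ1≈δ0 =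
    (λ _ → ≤.reflexive (sym (trans (sym (*-fromℕ-1 δ)) (trans δ1≈δ0 (zeroʳ δ))))) , λ ()
  SignCompatible-transfer δ (s≤s z≤n) z≤n       _ δ0≈δ1 =
    (λ ()) , λ _ → ≤.reflexive (trans (sym (*-fromℕ-1 δ)) (trans (sym δ0≈δ1) (zeroʳ δ)))

module Perturbation
  {c ℓ₁ ℓ₂ : Level} {R : OrderedCommutativeRing c ℓ₁ ℓ₂} (P : IRPSLP R)
  (φ : DualVec R P) (i : Fin (IRPSLP.k P)) (J : Fin (IRPSLP.k P) → Bool) (Δ : DualVec R P)
  where

  open OrderedCommutativeRingProperties R
  open IRPSLP P

  Assignment : Set
  Assignment = Fin (d i) → Bool

  incrementAt : Fin k → Fin (d i) → Carrier
  incrementAt j t = if J j then (_ᵀ·_ R (A i j) (Δ i j)) t else 0#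

  perturbedCost : Fin (d i) → Carrier
  perturbedCost t = θᵠ R P φ i t + ∑ R (λ j → incrementAt j t)

  gainAt : Fin k → Assignment → Carrier
  gainAt j x = ∑ R (λ s → Δ i j s * fromℕ ((A i j ·ℕ x) s))

  gain : Assignment → Carrier
  gain x = ∑ R (λ j → if J j then gainAt j x else 0#)

  ⟨perturbedCost⟩-split : ∀ x → ⟨_,_⟩ R perturbedCost x ≈ ⟨_,_⟩ R (θᵠ R P φ i) x + gain x
  ⟨perturbedCost⟩-split x = begin
    ⟨ perturbedCost , x ⟩ᴿ
      ≈⟨ ⟨⟩-distrib-+ (θᵠ R P φ i) (λ t → ∑ R (λ j → incrementAt j t)) x ⟩
    ⟨ θᵠ R P φ i , x ⟩ᴿ + ⟨ (λ t → ∑ R (λ j → incrementAt j t)) , x ⟩ᴿ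
      ≈⟨ +-congˡ (⟨⟩-distrib-∑ incrementAt x) ⟩
    ⟨ θᵠ R P φ i , x ⟩ᴿ + ∑ R (λ j → ⟨ incrementAt j , x ⟩ᴿ)
      ≈⟨ +-congˡ (∑-cong incrementAt-pairing) ⟩
    ⟨ θᵠ R P φ i , x ⟩ᴿ + gain x ∎
    where
    open SetoidReasoning setoid
    ⟨_,_⟩ᴿ : (Fin (d i) → Carrier) → Assignment → Carrier
    ⟨_,_⟩ᴿ = ⟨_,_⟩ R
    incrementAt-pairing : ∀ j → ⟨ incrementAt j , x ⟩ᴿ ≈ (if J j then gainAt j x else 0#)
    incrementAt-pairing j =
      trans (⟨⟩-if (J j) _ x) (if-cong (J j) (⟨ᵀ·⟩-adjoint (A i j) (Δ i j) x))

  SignCompatibleWith : Assignment → Set ℓ₂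
  SignCompatibleWith x = ∀ j → J j ≡ true → ∀ s → SignCompatible ((A i j ·ℕ x) s) (Δ i j s)

  module Admissible (J⊆N : ∀ j → J j ≡ true → E i j ≡ true)
           {x* : Assignment} (x*∈X : X i x*) (x*-compatible : SignCompatibleWith x*) where

    private
      binary : ∀ {x} → X i x → ∀ j → J j ≡ true → ∀ s → (A i j ·ℕ x) s ℕ.≤ 1
      binary x∈X j j∈J s = A-bin i j (J⊆N j j∈J) _ x∈X s

      termwise-≤ : ∀ {x} → X i x → ∀ j → J j ≡ true → ∀ s →
                   (Δ i j s * fromℕ ((A i j ·ℕ x) s)) ≤ (Δ i j s * fromℕ ((A i j ·ℕ x*) s))
      termwise-≤ x∈X j j∈J s =
        SignCompatible⇒maximal _ (binary x*∈X j j∈J s) (binary x∈X j j∈J s) (x*-compatible j j∈J s)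

      gainTerm-≤ : ∀ {x} → X i x → ∀ j →
                   (if J j then gainAt j x else 0#) ≤ (if J j then gainAt j x* else 0#)
      gainTerm-≤ x∈X j = if-mono-≤ (J j) (λ j∈J → ∑-mono-≤ (termwise-≤ x∈X j j∈J))

    gain-maximal : ∀ {x} → X i x → gain x ≤ gain x*
    gain-maximal x∈X = ∑-mono-≤ (gainTerm-≤ x∈X)

    gain-tie⇒SignCompatibleWith : ∀ {x} → X i x → gain x* ≤ gain x → SignCompatibleWith x
    gain-tie⇒SignCompatibleWith {x} x∈X gain-tie j j∈J s =
      SignCompatible-transfer _ (binary x*∈X j j∈J s) (binary x∈X j j∈J s) (x*-compatible j j∈J s)
        (∑-mono-≤-rigid (termwise-≤ x∈X j j∈J) (≤.reflexive (sym gainAt-tie)) s)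
      where
      gainAt-tie : gainAt j x ≈ gainAt j x*
      gainAt-tie = if-injective j∈J (∑-mono-≤-rigid (gainTerm-≤ x∈X) gain-tie j)

lemma4 : ∀ {c ℓ₁ ℓ₂ : Level} (R : OrderedCommutativeRing c ℓ₁ ℓ₂) (P : IRPSLP R)
           (φ : DualVec R P) → IsDual R P φ →
           (i : Fin (IRPSLP.k P)) (J : Fin (IRPSLP.k P) → Bool) →
           (∀ j → J j ≡ true → IRPSLP.E P i j ≡ true) →
           (x* x** : Fin (IRPSLP.d P i) → Bool) →
           IsMinimizer R (IRPSLP.X P i) (θᵠ R P φ i) x* →
           IsMinimizer R (IRPSLP.X P i) (θᵠ R P φ i) x** →
           (Δ : DualVec R P) →
           AD R P φ i J x* Δ → AD R P φ i J x** Δ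
lemma4 R P φ _ i J J⊆N x* x** _ (x**∈X , x**-min) Δ
       (outside-zero , antisymmetric , x*-compatible , (x*∈X , x*-min′)) =
  outside-zero , antisymmetric , gain-tie⇒SignCompatibleWith x**∈X gain-tie , (x**∈X , x**-min′)
  where
  open OrderedCommutativeRingProperties R
  open Perturbation P φ i J Δ
  open Admissible J⊆N x*∈X x*-compatible
  open PosetReasoning poset
  ⟨_⟩ᵠ ⟨_⟩′ : Assignment → Carrier
  ⟨ x ⟩ᵠ = ⟨_,_⟩ R (θᵠ R P φ i) x
  ⟨ x ⟩′ = ⟨_,_⟩ R perturbedCost x

  x**-min′ : ∀ y → IRPSLP.X P i y → ⟨ x** ⟩′ ≤ ⟨ y ⟩′
  x**-min′ y y∈X = begin
    ⟨ x** ⟩′             ≈⟨ ⟨perturbedCost⟩-split x** ⟩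
    ⟨ x** ⟩ᵠ + gain x**  ≤⟨ +-mono-≤ (x**-min x* x*∈X) (gain-maximal x**∈X) ⟩
    ⟨ x* ⟩ᵠ + gain x*    ≈⟨ ⟨perturbedCost⟩-split x* ⟨
    ⟨ x* ⟩′              ≤⟨ x*-min′ y y∈X ⟩
    ⟨ y ⟩′               ∎

  gain-tie : gain x* ≤ gain x**
  gain-tie = +-cancelˡ-≤ ⟨ x* ⟩ᵠ (begin
    ⟨ x* ⟩ᵠ + gain x*    ≈⟨ ⟨perturbedCost⟩-split x* ⟨
    ⟨ x* ⟩′              ≤⟨ x*-min′ x** x**∈X ⟩
    ⟨ x** ⟩′             ≈⟨ ⟨perturbedCost⟩-split x** ⟩
    ⟨ x** ⟩ᵠ + gain x**  ≤⟨ +-monoˡ-≤ (gain x**) (x**-min x* x*∈X) ⟩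
    ⟨ x* ⟩ᵠ + gain x**   ∎)
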